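{- Let $M$ be a normal orthogonal matroid on $[n]$. If $J\subseteq[n]$ is a nonempty basis of $M$, then there exists another basis $J'\subseteq J$ of $M$ with $|J'|=|J|-2$.
   Context: An orthogonal matroid on $E$ is a nonempty collection $\mathcal{B}$ of subsets of $E$ (its bases) such that for all $B_1,B_2\in\mathcal{B}$ and $x_1\in B_1\Delta B_2$ there is $x_2\in B_1\Delta B_2$, $x_2\ne x_1$, with $B_1\Delta\{x_1,x_2\}\in\mathcal{B}$ ($\Delta$ = symmetric difference). It is normal if $\emptyset$ is a basis. -}

module Defs where

open import Data.Nat using (ℕ)
open import Data.Fin using (Fin)
open import Data.Fin.Subset using (Subset; _∈_; _∪_; _─_; ⊥; ⁅_⁆)
open import Data.Product using (Σ; _×_; ∃)
open import Relation.Binary.PropositionalEquality using (_≢_)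
open import Level using (Level; suc)

_Δ_ : ∀ {n} → Subset n → Subset n → Subset n
A Δ B = (A ─ B) ∪ (B ─ A)

record OrthogonalMatroid (n : ℕ) : Set₁ where
  field
    IsBasis   : Subset n → Set
    nonempty  : ∃ λ B → IsBasis B
    exchange  : ∀ B₁ B₂ x₁ → IsBasis B₁ → IsBasis B₂ → x₁ ∈ (B₁ Δ B₂) →
                ∃ λ x₂ → x₂ ∈ (B₁ Δ B₂) × x₂ ≢ x₁ ×
                         IsBasis (B₁ Δ (⁅ x₁ ⁆ ∪ ⁅ x₂ ⁆))

Normal : ∀ {n} → OrthogonalMatroid n → Set
Normal M = OrthogonalMatroid.IsBasis M ⊥

{-# OPTIONS --safe #-}

-- Exchanging a basis J against the empty basis at some x₁ ∈ J yields a second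
-- element x₂ ∈ J Δ ∅ = J with x₂ ≠ x₁ such that J Δ {x₁, x₂} = J ∖ {x₁, x₂}
-- is a basis, and it has two elements fewer than J.

module Submission where

open import Defs
open import Data.Nat using (ℕ; _+_; suc)
open import Data.Nat.Properties using (+-suc)
open import Data.Fin using (Fin; zero; suc)
open import Data.Fin.Subset using (Subset; _⊆_; ∣_∣; Nonempty; _∈_; _∪_; ⁅_⁆; inside; outside)
  renaming (⊥ to ∅)
open import Data.Fin.Subset.Properties
  using (drop-∷-⊆; x∈p∪q⁻; x∈⁅y⁆⇒x≡y; ∣⁅x⁆∣≡1; ∪-identityˡ; ∪-identityʳ)
open import Data.Vec using (_∷_; []; here; there)
open import Data.Product using (∃; _×_; _,_)
open import Data.Sum using (inj₁; inj₂)
open import Relation.Nullary using (contradiction)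
open import Relation.Binary.PropositionalEquality
  using (_≡_; _≢_; refl; sym; trans; cong; subst)

private
  variable
    n : ℕ

Δ-identityʳ : (p : Subset n) → p Δ ∅ ≡ p
Δ-identityʳ []            = refl
Δ-identityʳ (inside ∷ p)  = cong (inside ∷_) (Δ-identityʳ p)
Δ-identityʳ (outside ∷ p) = cong (outside ∷_) (Δ-identityʳ p)

q⊆p⇒p∆q⊆p : {p q : Subset n} → q ⊆ p → p Δ q ⊆ p
q⊆p⇒p∆q⊆p {p = outside ∷ _} {inside ∷ _}  q⊆p here = contradiction (q⊆p here) λ ()
q⊆p⇒p∆q⊆p {p = inside ∷ _}  {outside ∷ _} q⊆p here = here
q⊆p⇒p∆q⊆p {p = _ ∷ _}       {_ ∷ _}       q⊆p (there x∈) = there (q⊆p⇒p∆q⊆p (drop-∷-⊆ q⊆p) x∈)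

q⊆p⇒∣p∆q∣+∣q∣≡∣p∣ : {p q : Subset n} → q ⊆ p → ∣ p Δ q ∣ + ∣ q ∣ ≡ ∣ p ∣
q⊆p⇒∣p∆q∣+∣q∣≡∣p∣ {p = []}          {[]}          _   = refl
q⊆p⇒∣p∆q∣+∣q∣≡∣p∣ {p = inside ∷ _}  {inside ∷ _}  q⊆p =
  trans (+-suc _ _) (cong suc (q⊆p⇒∣p∆q∣+∣q∣≡∣p∣ (drop-∷-⊆ q⊆p)))
q⊆p⇒∣p∆q∣+∣q∣≡∣p∣ {p = inside ∷ _}  {outside ∷ _} q⊆p =
  cong suc (q⊆p⇒∣p∆q∣+∣q∣≡∣p∣ (drop-∷-⊆ q⊆p))
q⊆p⇒∣p∆q∣+∣q∣≡∣p∣ {p = outside ∷ _} {outside ∷ _} q⊆p = q⊆p⇒∣p∆q∣+∣q∣≡∣p∣ (drop-∷-⊆ q⊆p)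
q⊆p⇒∣p∆q∣+∣q∣≡∣p∣ {p = outside ∷ _} {inside ∷ _}  q⊆p = contradiction (q⊆p here) λ ()

x≢y⇒∣⁅x⁆∪⁅y⁆∣≡2 : {x y : Fin n} → x ≢ y → ∣ ⁅ x ⁆ ∪ ⁅ y ⁆ ∣ ≡ 2
x≢y⇒∣⁅x⁆∪⁅y⁆∣≡2 {x = zero}  {zero}  x≢y = contradiction refl x≢y
x≢y⇒∣⁅x⁆∪⁅y⁆∣≡2 {x = zero}  {suc y} _   =
  cong suc (trans (cong ∣_∣ (∪-identityˡ ⁅ y ⁆)) (∣⁅x⁆∣≡1 y))
x≢y⇒∣⁅x⁆∪⁅y⁆∣≡2 {x = suc x} {zero}  _   =
  cong suc (trans (cong ∣_∣ (∪-identityʳ ⁅ x ⁆)) (∣⁅x⁆∣≡1 x))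
x≢y⇒∣⁅x⁆∪⁅y⁆∣≡2 {x = suc x} {suc y} x≢y = x≢y⇒∣⁅x⁆∪⁅y⁆∣≡2 (λ x≡y → x≢y (cong suc x≡y))

x,y∈p⇒⁅x⁆∪⁅y⁆⊆p : {p : Subset n} {x y : Fin n} → x ∈ p → y ∈ p → ⁅ x ⁆ ∪ ⁅ y ⁆ ⊆ p
x,y∈p⇒⁅x⁆∪⁅y⁆⊆p {p = p} {x} {y} x∈p y∈p z∈ with x∈p∪q⁻ ⁅ x ⁆ ⁅ y ⁆ z∈
... | inj₁ z∈⁅x⁆ = subst (_∈ p) (sym (x∈⁅y⁆⇒x≡y x z∈⁅x⁆)) x∈p
... | inj₂ z∈⁅y⁆ = subst (_∈ p) (sym (x∈⁅y⁆⇒x≡y y z∈⁅y⁆)) y∈p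

module _ (M : OrthogonalMatroid n) where
  open OrthogonalMatroid M

  exchange-with-∅ : Normal M → ∀ {J} → IsBasis J → ∀ {x₁} → x₁ ∈ J →
                    ∃ λ x₂ → x₂ ∈ J × x₂ ≢ x₁ × IsBasis (J Δ (⁅ x₁ ⁆ ∪ ⁅ x₂ ⁆))
  exchange-with-∅ normal {J} J-basis {x₁} x₁∈J
    with exchange J ∅ x₁ J-basis normal (subst (x₁ ∈_) (sym (Δ-identityʳ J)) x₁∈J)
  ... | x₂ , x₂∈JΔ∅ , x₂≢x₁ , basis = x₂ , subst (x₂ ∈_) (Δ-identityʳ J) x₂∈JΔ∅ , x₂≢x₁ , basis

lemma4p1 : (n : ℕ) (M : OrthogonalMatroid n) → Normal M →
    (J : Subset n) → OrthogonalMatroid.IsBasis M J → Nonempty J →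
    ∃ λ J′ → OrthogonalMatroid.IsBasis M J′ × J′ ⊆ J × ∣ J′ ∣ + 2 ≡ ∣ J ∣
lemma4p1 n M normal J J-basis (x₁ , x₁∈J)
  with exchange-with-∅ M normal J-basis x₁∈J
... | x₂ , x₂∈J , x₂≢x₁ , basis =
  J Δ pair , basis , q⊆p⇒p∆q⊆p pair⊆J ,
  trans (cong (∣ J Δ pair ∣ +_) (sym ∣pair∣≡2)) (q⊆p⇒∣p∆q∣+∣q∣≡∣p∣ pair⊆J)
  where
  pair = ⁅ x₁ ⁆ ∪ ⁅ x₂ ⁆
  pair⊆J : pair ⊆ J
  pair⊆J = x,y∈p⇒⁅x⁆∪⁅y⁆⊆p x₁∈J x₂∈J
  ∣pair∣≡2 : ∣ pair ∣ ≡ 2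
  ∣pair∣≡2 = x≢y⇒∣⁅x⁆∪⁅y⁆∣≡2 (λ x₁≡x₂ → x₂≢x₁ (sym x₁≡x₂))
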